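{- Let $t$ be an LSC term and $C,D$ shallow contexts with $C\prec_p t$ and $D\prec_p t$. If $C\!\downarrow\prec_{LO} D\!\downarrow$ then $C\prec_{LO}D$.
   Context: LSC terms: $t::= x\mid \lambda x.t\mid tu\mid t[x\leftarrow u]$ (explicit substitution binding $x$), modulo $\alpha$. Shallow contexts $C::=\langle\cdot\rangle\mid \lambda x.C\mid Ct\mid tC\mid C[x\leftarrow t]$. $C\prec_p t$ means $t=C\langle u\rangle$ for some $u$. Unfolding of terms: $x\!\downarrow=x$, $(tu)\!\downarrow=t\!\downarrow u\!\downarrow$, $(\lambda x.t)\!\downarrow=\lambda x.t\!\downarrow$, $(t[x\leftarrow u])\!\downarrow=t\!\downarrow\{x\leftarrow u\!\downarrow\}$ (meta-level substitution); unfolding of shallow contexts: $\langle\cdot\rangle\!\downarrow=\langle\cdot\rangle$, $(\lambda x.C)\!\downarrow=\lambda x.C\!\downarrow$, $(Ct)\!\downarrow=C\!\downarrow t\!\downarrow$, $(tC)\!\downarrow=t\!\downarrow C\!\downarrow$, $(C[x\leftarrow t])\!\downarrow=C\!\downarrow\{x\leftarrow t\!\downarrow\}$ with $\langle\cdot\rangle\{x\leftarrow t\}=\langle\cdot\rangle$. Outside-in order: $\langle\cdot\rangle\prec_O C$ for $C\neq\langle\cdot\rangle$, and $C\prec_O D$ implies $E\langle C\rangle\prec_O E\langle D\rangle$. Left-to-right order: if $C\prec_p t$ and $D\prec_p u$ then $Cu\prec_L tD$ and $C[x\leftarrow u]\prec_L t[x\leftarrow D]$; $C\prec_L D$ implies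 $E\langle C\rangle\prec_L E\langle D\rangle$. $C\prec_{LO}D$ iff $C\prec_O D$ or $C\prec_L D$. -}

module Defs where

open import Data.Nat using (ℕ; zero; suc; _+_; compare; less; equal; greater)
open import Data.Product using (∃)
open import Data.Sum using (_⊎_)
open import Relation.Binary.PropositionalEquality using (_≡_; _≢_)

-- LSC terms, modulo α: nameless (de Bruijn) representation.
--   lam t     : λx.t       (binds index 0 in t)
--   app t u   : t u
--   es t u    : t[x←u]     (binds index 0 in t, not in u)

data Term : Set where
  var : ℕ → Term
  lam : Term → Term
  app : Term → Term → Term
  es  : Term → Term → Term

shift : ℕ → Term → Term
shift c (var n) with compare n c
... | less _ _    = var n
... | equal _     = var (suc n)
... | greater _ _ = var (suc n)
shift c (lam t)   = lam (shift (suc c) t)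
shift c (app t u) = app (shift c t) (shift c u)
shift c (es t u)  = es (shift (suc c) t) (shift c u)

-- subst k s t : capture-avoiding meta-level substitution t{k←s},
-- removing the binder k (indices above k are decremented).
subst : ℕ → Term → Term → Term
subst k s (var n) with compare n k
... | less _ _      = var n
... | equal _       = s
... | greater _ j   = var (k + j)
subst k s (lam t)   = lam (subst (suc k) (shift 0 s) t)
subst k s (app t u) = app (subst k s t) (subst k s u)
subst k s (es t u)  = es (subst (suc k) (shift 0 s) t) (subst k s u)

unfold : Term → Term
unfold (var n)   = var n
unfold (lam t)   = lam (unfold t)
unfold (app t u) = app (unfold t) (unfold u)
unfold (es t u)  = subst 0 (unfold u) (unfold t)

-- General (one-hole) contexts, used for the orders.
--   cesL C t : C[x←t]     cesR t C : t[x←C]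

data Ctx : Set where
  hole  : Ctx
  clam  : Ctx → Ctx
  cappL : Ctx → Term → Ctx
  cappR : Term → Ctx → Ctx
  cesL  : Ctx → Term → Ctx
  cesR  : Term → Ctx → Ctx

-- plugging (may capture: no shifting, as usual for contexts)
plug : Ctx → Term → Term
plug hole       u = u
plug (clam C)    u = lam (plug C u)
plug (cappL C t) u = app (plug C u) t
plug (cappR t C) u = app t (plug C u)
plug (cesL C t)  u = es (plug C u) t
plug (cesR t C)  u = es t (plug C u)

cplug : Ctx → Ctx → Ctx
cplug hole        C = C
cplug (clam E)    C = clam (cplug E C)
cplug (cappL E t) C = cappL (cplug E C) t
cplug (cappR t E) C = cappR t (cplug E C)
cplug (cesL E t)  C = cesL (cplug E C) t
cplug (cesR t E)  C = cesR t (cplug E C)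

_≺p_ : Ctx → Term → Set
C ≺p t = ∃ λ u → plug C u ≡ t

csubst : ℕ → Term → Ctx → Ctx
csubst k s hole        = hole
csubst k s (clam C)    = clam (csubst (suc k) (shift 0 s) C)
csubst k s (cappL C t) = cappL (csubst k s C) (subst k s t)
csubst k s (cappR t C) = cappR (subst k s t) (csubst k s C)
csubst k s (cesL C t)  = cesL (csubst (suc k) (shift 0 s) C) (subst k s t)
csubst k s (cesR t C)  = cesR (subst (suc k) (shift 0 s) t) (csubst k s C)

data SCtx : Set where
  shole  : SCtx
  slam   : SCtx → SCtx
  sappL  : SCtx → Term → SCtx
  sappR  : Term → SCtx → SCtx
  sesL   : SCtx → Term → SCtx

embed : SCtx → Ctx
embed shole       = hole
embed (slam C)    = clam (embed C)
embed (sappL C t) = cappL (embed C) t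
embed (sappR t C) = cappR t (embed C)
embed (sesL C t)  = cesL (embed C) t

unfoldS : SCtx → Ctx
unfoldS shole       = hole
unfoldS (slam C)    = clam (unfoldS C)
unfoldS (sappL C t) = cappL (unfoldS C) (unfold t)
unfoldS (sappR t C) = cappR (unfold t) (unfoldS C)
unfoldS (sesL C t)  = csubst 0 (unfold t) (unfoldS C)

data _≺O_ : Ctx → Ctx → Set where
  root : ∀ {C} → C ≢ hole → hole ≺O C
  ctx  : ∀ E {C D} → C ≺O D → cplug E C ≺O cplug E D

data _≺L_ : Ctx → Ctx → Set where
  app  : ∀ {C t D u} → C ≺p t → D ≺p u → cappL C u ≺L cappR t D
  es   : ∀ {C t D u} → C ≺p t → D ≺p u → cesL C u ≺L cesR t D
  ctx  : ∀ E {C D} → C ≺L D → cplug E C ≺L cplug E D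

_≺LO_ : Ctx → Ctx → Set
C ≺LO D = C ≺O D ⊎ C ≺L D

module Submission where

open import Defs
open import Data.List using (List; []; _∷_; _++_)
open import Data.Product using (_×_; _,_)
open import Data.Sum using (inj₁; inj₂; [_,_]′)
open import Relation.Binary.PropositionalEquality
  using (_≡_; _≢_; refl; sym; trans; cong; subst₂)

-- Each order implies the corresponding order on hole positions (paths from
-- the root): strict prefix for ≺O, a left/right fork at an application or an
-- ES for ≺L.  Unfolding a shallow context keeps its shape except that the ES-body
-- steps disappear.  Two shallow contexts of the same term cross the same ES
-- nodes on their common part, always into the body, so an order between the
-- unfolded positions lifts back to the original contexts.

data Step : Set where
  λ-body app-fun app-arg es-body es-sub : Step

Position : Set
Position = List Step

position : Ctx → Position
position hole        = []
position (clam C)    = λ-body ∷ position C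
position (cappL C _) = app-fun ∷ position C
position (cappR _ C) = app-arg ∷ position C
position (cesL C _)  = es-body ∷ position C
position (cesR _ C)  = es-sub ∷ position C

position-cplug : ∀ E C → position (cplug E C) ≡ position E ++ position C
position-cplug hole        C = refl
position-cplug (clam E)    C = cong (λ-body ∷_) (position-cplug E C)
position-cplug (cappL E _) C = cong (app-fun ∷_) (position-cplug E C)
position-cplug (cappR _ E) C = cong (app-arg ∷_) (position-cplug E C)
position-cplug (cesL E _)  C = cong (es-body ∷_) (position-cplug E C)
position-cplug (cesR _ E)  C = cong (es-sub ∷_) (position-cplug E C)

position-csubst : ∀ k s C → position (csubst k s C) ≡ position C
position-csubst k s hole        = refl
position-csubst k s (clam C)    = cong (λ-body ∷_) (position-csubst _ _ C)
position-csubst k s (cappL C _) = cong (app-fun ∷_) (position-csubst _ _ C)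
position-csubst k s (cappR _ C) = cong (app-arg ∷_) (position-csubst _ _ C)
position-csubst k s (cesL C _)  = cong (es-body ∷_) (position-csubst _ _ C)
position-csubst k s (cesR _ C)  = cong (es-sub ∷_) (position-csubst _ _ C)

position↓ : SCtx → Position
position↓ shole       = []
position↓ (slam C)    = λ-body ∷ position↓ C
position↓ (sappL C _) = app-fun ∷ position↓ C
position↓ (sappR _ C) = app-arg ∷ position↓ C
position↓ (sesL C _)  = position↓ C

position-unfoldS : ∀ C → position (unfoldS C) ≡ position↓ C
position-unfoldS shole       = refl
position-unfoldS (slam C)    = cong (λ-body ∷_) (position-unfoldS C)
position-unfoldS (sappL C _) = cong (app-fun ∷_) (position-unfoldS C)
position-unfoldS (sappR _ C) = cong (app-arg ∷_) (position-unfoldS C)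
position-unfoldS (sesL C t)  = trans (position-csubst 0 (unfold t) (unfoldS C)) (position-unfoldS C)

infix 4 _<ᴸᴼ_

data _<ᴸᴼ_ : Position → Position → Set where
  outside     : ∀ {s q} → [] <ᴸᴼ s ∷ q
  app-fun<arg : ∀ {p q} → app-fun ∷ p <ᴸᴼ app-arg ∷ q
  es-body<sub : ∀ {p q} → es-body ∷ p <ᴸᴼ es-sub ∷ q
  inside      : ∀ {s p q} → p <ᴸᴼ q → s ∷ p <ᴸᴼ s ∷ q

<ᴸᴼ-++ : ∀ r {p q} → p <ᴸᴼ q → r ++ p <ᴸᴼ r ++ q
<ᴸᴼ-++ []      p<q = p<q
<ᴸᴼ-++ (_ ∷ r) p<q = inside (<ᴸᴼ-++ r p<q)

[]<ᴸᴼposition : ∀ C → C ≢ hole → [] <ᴸᴼ position C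
[]<ᴸᴼposition hole        C≢hole with () ← C≢hole refl
[]<ᴸᴼposition (clam _)    _ = outside
[]<ᴸᴼposition (cappL _ _) _ = outside
[]<ᴸᴼposition (cappR _ _) _ = outside
[]<ᴸᴼposition (cesL _ _)  _ = outside
[]<ᴸᴼposition (cesR _ _)  _ = outside

<ᴸᴼ-cplug : ∀ E C D → position C <ᴸᴼ position D →
            position (cplug E C) <ᴸᴼ position (cplug E D)
<ᴸᴼ-cplug E C D C<D rewrite position-cplug E C | position-cplug E D =
  <ᴸᴼ-++ (position E) C<D

≺O⇒<ᴸᴼ : ∀ {C D} → C ≺O D → position C <ᴸᴼ position D
≺O⇒<ᴸᴼ (root {D} D≢hole)    = []<ᴸᴼposition D D≢hole
≺O⇒<ᴸᴼ (ctx E {C} {D} C≺D) = <ᴸᴼ-cplug E C D (≺O⇒<ᴸᴼ C≺D)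

≺L⇒<ᴸᴼ : ∀ {C D} → C ≺L D → position C <ᴸᴼ position D
≺L⇒<ᴸᴼ (app _ _)           = app-fun<arg
≺L⇒<ᴸᴼ (es _ _)            = es-body<sub
≺L⇒<ᴸᴼ (ctx E {C} {D} C≺D) = <ᴸᴼ-cplug E C D (≺L⇒<ᴸᴼ C≺D)

≺LO⇒<ᴸᴼ : ∀ {C D} → C ≺LO D → position C <ᴸᴼ position D
≺LO⇒<ᴸᴼ = [ ≺O⇒<ᴸᴼ , ≺L⇒<ᴸᴼ ]′

≺LO-cplug : ∀ E {C D} → C ≺LO D → cplug E C ≺LO cplug E D
≺LO-cplug E = [ (λ C≺D → inj₁ (ctx E C≺D)) , (λ C≺D → inj₂ (ctx E C≺D)) ]′

lam-injective : ∀ {t u} → lam t ≡ lam u → t ≡ u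
lam-injective refl = refl

app-injective : ∀ {t t′ u u′} → Term.app t u ≡ Term.app t′ u′ → t ≡ t′ × u ≡ u′
app-injective refl = refl , refl

es-injective : ∀ {t t′ u u′} → Term.es t u ≡ Term.es t′ u′ → t ≡ t′ × u ≡ u′
es-injective refl = refl , refl

embed-≢-hole : ∀ D → [] <ᴸᴼ position↓ D → embed D ≢ hole
embed-≢-hole shole       ()
embed-≢-hole (slam _)    _ ()
embed-≢-hole (sappL _ _) _ ()
embed-≢-hole (sappR _ _) _ ()
embed-≢-hole (sesL _ _)  _ ()

<ᴸᴼ⇒≺LO : ∀ C D {u v} → plug (embed C) u ≡ plug (embed D) v →
          position↓ C <ᴸᴼ position↓ D → embed C ≺LO embed D
<ᴸᴼ⇒≺LO shole       D           _ C<D = inj₁ (root (embed-≢-hole D C<D))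
<ᴸᴼ⇒≺LO (slam _)    shole       _ ()
<ᴸᴼ⇒≺LO (slam C)    (slam D)    e (inside C<D) =
  ≺LO-cplug (clam hole) (<ᴸᴼ⇒≺LO C D (lam-injective e) C<D)
<ᴸᴼ⇒≺LO (slam _)    (sappL _ _) _ ()
<ᴸᴼ⇒≺LO (slam _)    (sappR _ _) _ ()
<ᴸᴼ⇒≺LO (slam _)    (sesL _ _)  () _
<ᴸᴼ⇒≺LO (sappL _ _) shole       _ ()
<ᴸᴼ⇒≺LO (sappL _ _) (slam _)    _ ()
<ᴸᴼ⇒≺LO (sappL C s) (sappL D _) e (inside C<D) with app-injective e
... | eC , refl = ≺LO-cplug (cappL hole s) (<ᴸᴼ⇒≺LO C D eC C<D)
<ᴸᴼ⇒≺LO (sappL _ _) (sappR _ _) e app-fun<arg with app-injective e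
... | eC , eD = inj₂ (app (_ , eC) (_ , sym eD))
<ᴸᴼ⇒≺LO (sappL _ _) (sesL _ _)  () _
<ᴸᴼ⇒≺LO (sappR _ _) shole       _ ()
<ᴸᴼ⇒≺LO (sappR _ _) (slam _)    _ ()
<ᴸᴼ⇒≺LO (sappR _ _) (sappL _ _) _ ()
<ᴸᴼ⇒≺LO (sappR s C) (sappR _ D) e (inside C<D) with app-injective e
... | refl , eC = ≺LO-cplug (cappR s hole) (<ᴸᴼ⇒≺LO C D eC C<D)
<ᴸᴼ⇒≺LO (sappR _ _) (sesL _ _)  () _
<ᴸᴼ⇒≺LO (sesL _ _)  shole       _ ()
<ᴸᴼ⇒≺LO (sesL _ _)  (slam _)    () _
<ᴸᴼ⇒≺LO (sesL _ _)  (sappL _ _) () _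
<ᴸᴼ⇒≺LO (sesL _ _)  (sappR _ _) () _
<ᴸᴼ⇒≺LO (sesL C s)  (sesL D _)  e C<D with es-injective e
... | eC , refl = ≺LO-cplug (cesL hole s) (<ᴸᴼ⇒≺LO C D eC C<D)

mainTheorem18 : (t : Term) (C D : SCtx) →
    embed C ≺p t → embed D ≺p t →
    unfoldS C ≺LO unfoldS D → embed C ≺LO embed D
mainTheorem18 _ C D (_ , eC) (_ , eD) C↓≺D↓ =
  <ᴸᴼ⇒≺LO C D (trans eC (sym eD))
    (subst₂ _<ᴸᴼ_ (position-unfoldS C) (position-unfoldS D) (≺LO⇒<ᴸᴼ C↓≺D↓))
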